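{- Let $t$ and $n$ be positive integers. (i) If $t=2m+1$ and $c=(-c_m,\ldots,-c_1,0,c_1,\ldots,c_m)\in SC_{t,n}$ (integers $c_1,\ldots,c_m$), then $n=t\sum_{j=1}^m c_j^2+\sum_{j=1}^m 2j\,c_j$. (ii) If $t=2m$ and $c=(-c_m,\ldots,-c_1,c_1,\ldots,c_m)\in SC_{t,n}$, then $n=t\sum_{j=1}^m c_j^2+\sum_{j=1}^m (2j-1)c_j$.
   Context: $\mathbb N=\{0,1,2,\ldots\}$. A partition is determined by its arm set $A^+(\lambda)=\{\lambda_i-i:1\le i\le s\}$ and leg set $L^+(\lambda)=\{\lambda^*_i-i:1\le i\le s\}$, where $s=\#\{i:\lambda_i\ge i\}$ and $\lambda^*$ is the conjugate; any two finite subsets of $\mathbb N$ of equal cardinality are the leg and arm sets of a unique partition. For $c=(c_0,\ldots,c_{t-1})\in\mathbb Z^t$ with coordinate sum $0$, $\lambda_c$ is the partition with arm set $\{qt+j: 0\le q<c_j\}$ and leg set $\{qt+t-j-1: 0\le q<-c_j\}$ (over $0\le j\le t-1$). $SC_{t,n}$ is the set of such $c$ with $|\lambda_c|=n$ and $\lambda_c^*=\lambda_c$. Vectors are written with coordinates indexed $0,\ldots,t-1$ from left to right. -}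

module Defs where

open import Data.Nat using (ℕ; zero; suc; _+_; _*_; _∸_; _≤_; _<_; _≤?_)
open import Data.Integer as ℤ using (ℤ; +_; -_)
open import Data.List using (List; []; _∷_; length; filter)
open import Data.List.Relation.Unary.All using (All)
open import Data.List.Relation.Unary.Linked using (Linked)
open import Data.Product using (Σ; Σ-syntax; ∃; ∃-syntax; _×_)
open import Relation.Binary.PropositionalEquality using (_≡_)
open import Data.Nat using (_≥_; _<?_)
open import Data.Nat.ListAction using (sum)
open import Relation.Nullary using (yes; no)

record Partition : Set where
  constructor mkPartition
  field
    parts      : List ℕ
    decreasing : Linked _≥_ parts
    positive   : All (1 ≤_) parts
open Partition public

-- λ_i (1-indexed); 0 beyond the length.
partAt : List ℕ → ℕ → ℕ
partAt []       _             = 0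
partAt (x ∷ xs) zero          = 0   -- index 0 is unused (parts are 1-indexed)
partAt (x ∷ xs) (suc zero)    = x
partAt (x ∷ xs) (suc (suc i)) = partAt xs (suc i)

part : Partition → ℕ → ℕ
part λp i = partAt (parts λp) i

conjPart : Partition → ℕ → ℕ
conjPart λp i = length (filter (i ≤?_) (parts λp))

size : Partition → ℕ
size λp = sum (parts λp)

countDiag : ℕ → List ℕ → ℕ
countDiag i []       = 0
countDiag i (x ∷ xs) with i ≤? x
... | yes _ = suc (countDiag (suc i) xs)
... | no  _ = countDiag (suc i) xs

durfee : Partition → ℕ
durfee λp = countDiag 1 (parts λp)

InArm : Partition → ℕ → Set
InArm λp x = ∃[ i ] (1 ≤ i × i ≤ durfee λp × x ≡ part λp i ∸ i)

InLeg : Partition → ℕ → Set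
InLeg λp x = ∃[ i ] (1 ≤ i × i ≤ durfee λp × x ≡ conjPart λp i ∸ i)

SelfConjugate : Partition → Set
SelfConjugate λp = ∀ i → 1 ≤ i → conjPart λp i ≡ part λp i

sumℤ : ℕ → (ℕ → ℤ) → ℤ
sumℤ zero    f = + 0
sumℤ (suc n) f = sumℤ n f ℤ.+ f n

-- Vectors c ∈ ℤ^t are functions ℕ → ℤ, coordinates 0..t-1 being relevant.
-- Arm set of λ_c: { q t + j : 0 ≤ j < t, 0 ≤ q < c_j }
InArmC : ℕ → (ℕ → ℤ) → ℕ → Set
InArmC t c x = ∃[ j ] ∃[ q ] (j < t × (+ q) ℤ.< c j × x ≡ q * t + j)

InLegC : ℕ → (ℕ → ℤ) → ℕ → Set
InLegC t c x = ∃[ j ] ∃[ q ] (j < t × (+ q) ℤ.< - c j × x ≡ q * t + (t ∸ j ∸ 1))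

IsLambdaC : ℕ → (ℕ → ℤ) → Partition → Set
IsLambdaC t c λp =
  (∀ x → (InArm λp x → InArmC t c x) × (InArmC t c x → InArm λp x)) ×
  (∀ x → (InLeg λp x → InLegC t c x) × (InLegC t c x → InLeg λp x))

InSC : ℕ → ℕ → (ℕ → ℤ) → Set
InSC t n c =
  sumℤ t c ≡ + 0 ×
  Σ[ λp ∈ Partition ] (IsLambdaC t c λp × size λp ≡ n × SelfConjugate λp)

-- c = (-c_m,…,-c_1,0,c_1,…,c_m), with d j = c_j (j = 1..m)
oddVec : ℕ → (ℕ → ℤ) → ℕ → ℤ
oddVec m d k with k <? m | m <? k
... | yes _ | _ = - d (m ∸ k)
... | no _ | yes _ = d (k ∸ m)
... | no _ | no _ = + 0

-- c = (-c_m,…,-c_1,c_1,…,c_m), with d j = c_j (j = 1..m)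
evenVec : ℕ → (ℕ → ℤ) → ℕ → ℤ
evenVec m d k with k <? m
... | yes _ = - d (m ∸ k)
... | no _ = d (suc (k ∸ m))

-- A self-conjugate partition has equal arms and legs, so Frobenius' decomposition of
-- |λ| into the hooks of its diagonal cells gives |λ| = Σ_{a ∈ A⁺(λ)} (2a + 1).
-- For λ = λ_c the arm set is the disjoint union over residues j < t of
-- {qt + j : 0 ≤ q < c_j}, and this residue class contributes t c_j² + (2j + 1 − t) c_j
-- when c_j ≥ 0 and nothing otherwise.  The vectors in question satisfy
-- c_{t-1-j} = −c_j, so for each antipodal pair {j, t − 1 − j} exactly one of the two
-- classes contributes, and in either case the pair contributes t c_j² + (2j + 1 − t) c_j
-- for its upper member j.

module Submission where

open import Defs
open import Data.Nat using (ℕ; suc; _+_; _*_; _≤_; _∸_)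
open import Data.Integer as ℤ using (ℤ; +_)
open import Data.Product using (_×_)
open import Relation.Binary.PropositionalEquality using (_≡_)

open import Data.Integer using (-[1+_])
import Data.Integer.Properties as ℤP
import Data.Integer.Tactic.RingSolver as ℤ-Solver
open import Data.List using (List; []; _∷_; length; filter; map; applyUpTo; upTo; applyDownFrom; concat)
open import Data.List.Membership.Propositional using (_∈_)
open import Data.List.Membership.Propositional.Properties
  using (∈-applyUpTo⁺; ∈-applyUpTo⁻; ∈-applyDownFrom⁺; ∈-applyDownFrom⁻; ∈-concat⁺; ∈-concat⁻)
open import Data.List.Membership.Propositional.Properties.WithK using (unique∧set⇒bag)
open import Data.List.Properties
  using (map-upTo; map-cong; map-applyUpTo; map-applyDownFrom; concat-map; filter-none; filter-accept; filter-reject)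
open import Data.List.Relation.Binary.BagAndSetEquality using (_∼[_]_; set; ∼bag⇒↭)
open import Data.List.Relation.Binary.Disjoint.Propositional using (Disjoint)
open import Data.List.Relation.Binary.Permutation.Propositional.Properties using (map⁺)
open import Data.List.Relation.Unary.All as All using (All; []; _∷_)
import Data.List.Relation.Unary.All.Properties as All
import Data.List.Relation.Unary.AllPairs.Properties as AllPairs
import Data.List.Relation.Unary.Any.Properties as Any
open import Data.List.Relation.Unary.Linked as Linked using (Linked; _∷_)
open import Data.List.Relation.Unary.Linked.Properties using (Linked⇒All) renaming (map⁺ to Linked-map⁺)
open import Data.List.Relation.Unary.Unique.Propositional using (Unique)
open import Data.List.Relation.Unary.Unique.Propositional.Properties using (applyUpTo⁺₁; applyDownFrom⁺₁; concat⁺)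
open import Data.Nat using (zero; _<_; _≥_; z≤n; s≤s; s≤s⁻¹; z<s; pred)
open import Data.Nat.DivMod using (_%_; [m+kn]%n≡m%n; m<n⇒m%n≡m)
open import Data.Nat.ListAction using (sum)
open import Data.Nat.ListAction.Properties using (sum-++; sum-↭)
open import Data.Nat.Properties
import Data.Nat.Tactic.RingSolver as ℕ-Solver
open import Data.Product using (_,_; proj₁; proj₂)
open import Data.Sum using (inj₁; inj₂)
open import Function.Bundles using (_⇔_; mk⇔; Equivalence)
open import Function.Properties.Equivalence using () renaming (trans to ⇔-trans; sym to ⇔-sym)
open import Relation.Nullary using (yes; no; ¬_; contradiction)
open import Algebra.Properties.CommutativeSemigroup +-commutativeSemigroup using (x∙yz≈y∙xz)
open import Algebra.Properties.CommutativeSemigroup ℤP.+-commutativeSemigroup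
  using () renaming (interchange to ℤ-interchange; xy∙z≈y∙xz to ℤ-xy∙z≈y∙xz)
open import Relation.Binary.PropositionalEquality using (refl; sym; trans; cong; cong₂; subst; module ≡-Reasoning)

applyUpTo-cong : ∀ {A : Set} {f g : ℕ → A} n → (∀ i → f i ≡ g i) → applyUpTo f n ≡ applyUpTo g n
applyUpTo-cong {f = f} {g} n f≗g = begin
  applyUpTo f n   ≡⟨ map-upTo f n ⟨
  map f (upTo n)  ≡⟨ map-cong f≗g (upTo n) ⟩
  map g (upTo n)  ≡⟨ map-upTo g n ⟩
  applyUpTo g n   ∎
  where open ≡-Reasoning

sum-concat : ∀ xss → sum (concat xss) ≡ sum (map sum xss)
sum-concat [] = refl
sum-concat (xs ∷ xss) = trans (sum-++ xs (concat xss)) (cong (λ s → sum xs + s) (sum-concat xss))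

sum-zeros : ∀ {xs} → All (_< 1) xs → sum xs ≡ 0
sum-zeros [] = refl
sum-zeros (z<s ∷ zs) = sum-zeros zs

sum-applyDownFrom-ℤ : ∀ n (f : ℕ → ℕ) → + sum (applyDownFrom f n) ≡ sumℤ n (λ k → + f k)
sum-applyDownFrom-ℤ zero f = refl
sum-applyDownFrom-ℤ (suc n) f = begin
  + (f n + sum (applyDownFrom f n))    ≡⟨ ℤP.pos-+ (f n) (sum (applyDownFrom f n)) ⟩
  + f n ℤ.+ + sum (applyDownFrom f n)  ≡⟨ ℤP.+-comm (+ f n) (+ sum (applyDownFrom f n)) ⟩
  + sum (applyDownFrom f n) ℤ.+ + f n  ≡⟨ cong (ℤ._+ + f n) (sum-applyDownFrom-ℤ n f) ⟩
  sumℤ n (λ k → + f k) ℤ.+ + f n       ∎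
  where open ≡-Reasoning

sumℤ-cong : ∀ n {f g : ℕ → ℤ} → (∀ k → k < n → f k ≡ g k) → sumℤ n f ≡ sumℤ n g
sumℤ-cong zero _ = refl
sumℤ-cong (suc n) f≗g = cong₂ ℤ._+_ (sumℤ-cong n (λ k k<n → f≗g k (m<n⇒m<1+n k<n))) (f≗g n ≤-refl)

sumℤ-+ : ∀ n (f g : ℕ → ℤ) → sumℤ n (λ k → f k ℤ.+ g k) ≡ sumℤ n f ℤ.+ sumℤ n g
sumℤ-+ zero f g = refl
sumℤ-+ (suc n) f g =
  trans (cong (ℤ._+ (f n ℤ.+ g n)) (sumℤ-+ n f g)) (ℤ-interchange (sumℤ n f) (sumℤ n g) (f n) (g n))

sumℤ-*ˡ : ∀ n a (f : ℕ → ℤ) → sumℤ n (λ k → a ℤ.* f k) ≡ a ℤ.* sumℤ n f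
sumℤ-*ˡ zero a f = sym (ℤP.*-zeroʳ a)
sumℤ-*ˡ (suc n) a f =
  trans (cong (ℤ._+ (a ℤ.* f n)) (sumℤ-*ˡ n a f)) (sym (ℤP.*-distribˡ-+ a (sumℤ n f) (f n)))

sumℤ-split : ∀ a b (f : ℕ → ℤ) → sumℤ (a + b) f ≡ sumℤ a f ℤ.+ sumℤ b (λ k → f (a + k))
sumℤ-split a zero f rewrite +-identityʳ a = sym (ℤP.+-identityʳ (sumℤ a f))
sumℤ-split a (suc b) f rewrite +-suc a b =
  trans (cong (ℤ._+ f (a + b)) (sumℤ-split a b f)) (ℤP.+-assoc (sumℤ a f) (sumℤ b (λ k → f (a + k))) (f (a + b)))

sumℤ-reverse : ∀ n (f : ℕ → ℤ) → sumℤ n f ≡ sumℤ n (λ k → f (n ∸ suc k))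
sumℤ-reverse zero f = refl
sumℤ-reverse (suc n) f = begin
  sumℤ n f ℤ.+ f n                                           ≡⟨ cong (ℤ._+ f n) (sumℤ-reverse n f) ⟩
  sumℤ n (λ k → f (n ∸ suc k)) ℤ.+ f n                       ≡⟨ ℤP.+-comm _ (f n) ⟩
  f n ℤ.+ sumℤ n (λ k → f (n ∸ suc k))                       ≡⟨ cong (ℤ._+ sumℤ n (λ k → f (n ∸ suc k))) (ℤP.+-identityˡ (f n)) ⟨
  sumℤ 1 (λ k → f (n ∸ k)) ℤ.+ sumℤ n (λ k → f (n ∸ suc k))  ≡⟨ sumℤ-split 1 n (λ k → f (n ∸ k)) ⟨
  sumℤ (suc n) (λ k → f (suc n ∸ suc k))                     ∎
  where open ≡-Reasoning

sumℤ-foldEven : ∀ m (G : ℕ → ℤ) → sumℤ (m + m) G ≡ sumℤ m (λ k → G (m ∸ suc k) ℤ.+ G (m + k))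
sumℤ-foldEven m G = begin
  sumℤ (m + m) G                                             ≡⟨ sumℤ-split m m G ⟩
  sumℤ m G ℤ.+ sumℤ m (λ k → G (m + k))                      ≡⟨ cong (ℤ._+ sumℤ m (λ k → G (m + k))) (sumℤ-reverse m G) ⟩
  sumℤ m (λ k → G (m ∸ suc k)) ℤ.+ sumℤ m (λ k → G (m + k))  ≡⟨ sumℤ-+ m (λ k → G (m ∸ suc k)) (λ k → G (m + k)) ⟨
  sumℤ m (λ k → G (m ∸ suc k) ℤ.+ G (m + k))                 ∎
  where open ≡-Reasoning

sumℤ-foldOdd : ∀ m (G : ℕ → ℤ) → sumℤ (suc m + m) G ≡ G m ℤ.+ sumℤ m (λ k → G (m ∸ suc k) ℤ.+ G (suc m + k))
sumℤ-foldOdd m G = begin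
  sumℤ (suc m + m) G                                    ≡⟨ sumℤ-split (suc m) m G ⟩
  (sumℤ m G ℤ.+ G m) ℤ.+ upper                          ≡⟨ cong (λ s → (s ℤ.+ G m) ℤ.+ upper) (sumℤ-reverse m G) ⟩
  (lower ℤ.+ G m) ℤ.+ upper                             ≡⟨ ℤ-xy∙z≈y∙xz lower (G m) upper ⟩
  G m ℤ.+ (lower ℤ.+ upper)                             ≡⟨ cong (λ s → G m ℤ.+ s) (sumℤ-+ m (λ k → G (m ∸ suc k)) (λ k → G (suc m + k))) ⟨
  G m ℤ.+ sumℤ m (λ k → G (m ∸ suc k) ℤ.+ G (suc m + k)) ∎
  where
  open ≡-Reasoning
  lower upper : ℤ
  lower = sumℤ m (λ k → G (m ∸ suc k))
  upper = sumℤ m (λ k → G (suc m + k))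

-- Frobenius' hook decomposition

countAtLeast : ℕ → List ℕ → ℕ
countAtLeast i xs = length (filter (i ≤?_) xs)

arm : List ℕ → ℕ → ℕ
arm xs r = partAt xs (suc r) ∸ suc r

leg : List ℕ → ℕ → ℕ
leg xs r = countAtLeast (suc r) xs ∸ suc r

diagonalHook : List ℕ → ℕ → ℕ
diagonalHook xs r = arm xs r + leg xs r + 1

decreasing-All< : ∀ {k x xs} → Linked _≥_ (x ∷ xs) → x < k → All (_< k) (x ∷ xs)
decreasing-All< dec x<k =
  All.map (λ y≤x → ≤-<-trans y≤x x<k) (Linked⇒All (λ i≥j j≥k → ≤-trans j≥k i≥j) ≤-refl dec)

map-pred-decreasing : ∀ {xs} → Linked _≥_ xs → Linked _≥_ (map pred xs)
map-pred-decreasing dec = Linked-map⁺ (Linked.map pred-mono-≤ dec)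

countAtLeast-none : ∀ {i xs} → All (_< i) xs → countAtLeast i xs ≡ 0
countAtLeast-none xs<i = cong length (filter-none (_ ≤?_) (All.map <⇒≱ xs<i))

countAtLeast-accept : ∀ {i x} xs → i ≤ x → countAtLeast i (x ∷ xs) ≡ suc (countAtLeast i xs)
countAtLeast-accept {i} xs i≤x = cong length (filter-accept (i ≤?_) i≤x)

countAtLeast-reject : ∀ {i x} xs → ¬ i ≤ x → countAtLeast i (x ∷ xs) ≡ countAtLeast i xs
countAtLeast-reject {i} xs i≰x = cong length (filter-reject (i ≤?_) i≰x)

countAtLeast-map-pred : ∀ i ys → countAtLeast (suc i) (map pred ys) ≡ countAtLeast (2 + i) ys
countAtLeast-map-pred i [] = refl
countAtLeast-map-pred i (zero ∷ ys) = countAtLeast-map-pred i ys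
countAtLeast-map-pred i (suc y ∷ ys) with ≤-<-connex (suc i) y
... | inj₁ i<y = begin
  countAtLeast (suc i) (y ∷ map pred ys)    ≡⟨ countAtLeast-accept (map pred ys) i<y ⟩
  suc (countAtLeast (suc i) (map pred ys))  ≡⟨ cong suc (countAtLeast-map-pred i ys) ⟩
  suc (countAtLeast (2 + i) ys)             ≡⟨ countAtLeast-accept ys (s≤s i<y) ⟨
  countAtLeast (2 + i) (suc y ∷ ys)         ∎
  where open ≡-Reasoning
... | inj₂ y≤i = begin
  countAtLeast (suc i) (y ∷ map pred ys)    ≡⟨ countAtLeast-reject (map pred ys) (<⇒≱ y≤i) ⟩
  countAtLeast (suc i) (map pred ys)        ≡⟨ countAtLeast-map-pred i ys ⟩
  countAtLeast (2 + i) ys                   ≡⟨ countAtLeast-reject ys (<⇒≱ (s≤s y≤i)) ⟨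
  countAtLeast (2 + i) (suc y ∷ ys)         ∎
  where open ≡-Reasoning

countDiag-accept : ∀ {i x} xs → i ≤ x → countDiag i (x ∷ xs) ≡ suc (countDiag (suc i) xs)
countDiag-accept {i} {x} xs i≤x with i ≤? x
... | yes _ = refl
... | no i≰x = contradiction i≤x i≰x

countDiag-reject : ∀ {i x} xs → ¬ i ≤ x → countDiag i (x ∷ xs) ≡ countDiag (suc i) xs
countDiag-reject {i} {x} xs i≰x with i ≤? x
... | yes i≤x = contradiction i≤x i≰x
... | no _ = refl

countDiag-none : ∀ {k xs} → All (_< k) xs → countDiag k xs ≡ 0
countDiag-none [] = refl
countDiag-none {xs = x ∷ xs} (x<k ∷ xs<k) =
  trans (countDiag-reject xs (<⇒≱ x<k)) (countDiag-none (All.map m≤n⇒m≤1+n xs<k))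

countDiag-map-pred : ∀ k ys → countDiag (suc k) (map pred ys) ≡ countDiag (2 + k) ys
countDiag-map-pred k [] = refl
countDiag-map-pred k (zero ∷ ys) = countDiag-map-pred (suc k) ys
countDiag-map-pred k (suc y ∷ ys) with ≤-<-connex (suc k) y
... | inj₁ k<y = begin
  countDiag (suc k) (y ∷ map pred ys)  ≡⟨ countDiag-accept (map pred ys) k<y ⟩
  suc (countDiag (2 + k) (map pred ys)) ≡⟨ cong suc (countDiag-map-pred (suc k) ys) ⟩
  suc (countDiag (3 + k) ys)           ≡⟨ countDiag-accept ys (s≤s k<y) ⟨
  countDiag (2 + k) (suc y ∷ ys)       ∎
  where open ≡-Reasoning
... | inj₂ y≤k = begin
  countDiag (suc k) (y ∷ map pred ys)  ≡⟨ countDiag-reject (map pred ys) (<⇒≱ y≤k) ⟩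
  countDiag (2 + k) (map pred ys)      ≡⟨ countDiag-map-pred (suc k) ys ⟩
  countDiag (3 + k) ys                 ≡⟨ countDiag-reject ys (<⇒≱ (s≤s y≤k)) ⟨
  countDiag (2 + k) (suc y ∷ ys)       ∎
  where open ≡-Reasoning

sum≡countAtLeast+sum-map-pred : ∀ ys → sum ys ≡ countAtLeast 1 ys + sum (map pred ys)
sum≡countAtLeast+sum-map-pred [] = refl
sum≡countAtLeast+sum-map-pred (zero ∷ ys) = sum≡countAtLeast+sum-map-pred ys
sum≡countAtLeast+sum-map-pred (suc y ∷ ys) = begin
  suc y + sum ys                                     ≡⟨ cong (λ s → suc y + s) (sum≡countAtLeast+sum-map-pred ys) ⟩
  suc y + (countAtLeast 1 ys + sum (map pred ys))    ≡⟨ cong suc (x∙yz≈y∙xz y (countAtLeast 1 ys) (sum (map pred ys))) ⟩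
  suc (countAtLeast 1 ys) + (y + sum (map pred ys))  ∎
  where open ≡-Reasoning

partAt-map-pred : ∀ ys i → partAt (map pred ys) i ≡ pred (partAt ys i)
partAt-map-pred [] i = refl
partAt-map-pred (y ∷ ys) zero = refl
partAt-map-pred (y ∷ ys) (suc zero) = refl
partAt-map-pred (y ∷ ys) (suc (suc i)) = partAt-map-pred ys (suc i)

arm-map-pred : ∀ ys r → arm (map pred ys) r ≡ partAt ys (suc r) ∸ (2 + r)
arm-map-pred ys r =
  trans (cong (_∸ suc r) (partAt-map-pred ys (suc r))) (∸-+-assoc (partAt ys (suc r)) 1 (suc r))

leg-map-pred : ∀ {x ys} → Linked _≥_ (suc x ∷ ys) → ∀ r → leg (suc x ∷ ys) (suc r) ≡ leg (map pred ys) r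
leg-map-pred {x} {ys} dec r with ≤-<-connex (2 + r) (suc x)
... | inj₁ r<x = begin
  countAtLeast (2 + r) (suc x ∷ ys) ∸ (2 + r)   ≡⟨ cong (_∸ (2 + r)) (countAtLeast-accept ys r<x) ⟩
  countAtLeast (2 + r) ys ∸ (1 + r)             ≡⟨ cong (_∸ (1 + r)) (countAtLeast-map-pred r ys) ⟨
  countAtLeast (1 + r) (map pred ys) ∸ (1 + r)  ∎
  where open ≡-Reasoning
... | inj₂ x≤r = begin
  countAtLeast (2 + r) (suc x ∷ ys) ∸ (2 + r)   ≡⟨ cong (_∸ (2 + r)) (countAtLeast-reject ys (<⇒≱ x≤r)) ⟩
  countAtLeast (2 + r) ys ∸ (2 + r)             ≡⟨ cong (_∸ (2 + r)) none ⟩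
  0                                             ≡⟨ cong (_∸ (1 + r)) none ⟨
  countAtLeast (2 + r) ys ∸ (1 + r)             ≡⟨ cong (_∸ (1 + r)) (countAtLeast-map-pred r ys) ⟨
  countAtLeast (1 + r) (map pred ys) ∸ (1 + r)  ∎
  where
  open ≡-Reasoning
  none : countAtLeast (2 + r) ys ≡ 0
  none = countAtLeast-none (All.tail (decreasing-All< dec x≤r))

diagonalHook-map-pred : ∀ {x ys} → Linked _≥_ (suc x ∷ ys) → ∀ r →
                        diagonalHook (suc x ∷ ys) (suc r) ≡ diagonalHook (map pred ys) r
diagonalHook-map-pred {ys = ys} dec r =
  cong₂ (λ a l → a + l + 1) (sym (arm-map-pred ys r)) (leg-map-pred dec r)

-- Removing the hook of the corner cell of λ = (suc x ∷ ys) leaves map pred ys, whose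
-- diagonal hooks are those of λ shifted by one.
sum≡sum-diagonalHooks : ∀ s xs → Linked _≥_ xs → countDiag 1 xs ≡ s →
                        sum xs ≡ sum (applyUpTo (diagonalHook xs) s)
sum≡sum-diagonalHooks _ [] _ refl = refl
sum≡sum-diagonalHooks _ (zero ∷ ys) dec refl
  rewrite countDiag-none (All.tail (decreasing-All< {2} dec z<s)) = sum-zeros (decreasing-All< dec z<s)
sum≡sum-diagonalHooks (suc s) (suc x ∷ ys) dec diag = begin
  suc x + sum ys
    ≡⟨ cong (λ n → suc x + n) (sum≡countAtLeast+sum-map-pred ys) ⟩
  suc x + (countAtLeast 1 ys + sum (map pred ys))
    ≡⟨ +-assoc (suc x) (countAtLeast 1 ys) (sum (map pred ys)) ⟨
  suc x + countAtLeast 1 ys + sum (map pred ys)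
    ≡⟨ cong (_+ sum (map pred ys)) (+-comm 1 (x + countAtLeast 1 ys)) ⟩
  corner + sum (map pred ys)
    ≡⟨ cong (λ n → corner + n) (sum≡sum-diagonalHooks s (map pred ys) (map-pred-decreasing (Linked.tail dec)) diag′) ⟩
  corner + sum (applyUpTo (diagonalHook (map pred ys)) s)
    ≡⟨ cong (λ l → corner + sum l) (applyUpTo-cong s (λ r → sym (diagonalHook-map-pred dec r))) ⟩
  sum (applyUpTo (diagonalHook (suc x ∷ ys)) (suc s)) ∎
  where
  open ≡-Reasoning
  corner : ℕ
  corner = diagonalHook (suc x ∷ ys) 0
  diag′ : countDiag 1 (map pred ys) ≡ s
  diag′ = trans (countDiag-map-pred 0 ys) (suc-injective diag)

-- The arms of a self-conjugate partition

armList : Partition → List ℕ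
armList λp = applyUpTo (arm (parts λp)) (durfee λp)

size-selfConjugate : (λp : Partition) → SelfConjugate λp → size λp ≡ sum (map (λ a → a + a + 1) (armList λp))
size-selfConjugate λp sc = begin
  size λp                                                      ≡⟨ sum≡sum-diagonalHooks (durfee λp) xs (decreasing λp) refl ⟩
  sum (applyUpTo (diagonalHook xs) (durfee λp))                ≡⟨ cong sum (applyUpTo-cong (durfee λp) leg≡arm) ⟩
  sum (applyUpTo (λ r → arm xs r + arm xs r + 1) (durfee λp))  ≡⟨ cong sum (map-applyUpTo (arm xs) (λ a → a + a + 1) (durfee λp)) ⟨
  sum (map (λ a → a + a + 1) (armList λp))                     ∎
  where
  open ≡-Reasoning
  xs : List ℕ
  xs = parts λp
  leg≡arm : ∀ r → diagonalHook xs r ≡ arm xs r + arm xs r + 1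
  leg≡arm r = cong (λ l → arm xs r + (l ∸ suc r) + 1) (sc (suc r) (s≤s z≤n))

partAt-antitone : ∀ {xs i j} → Linked _≥_ xs → i ≤ j → partAt xs (suc j) ≤ partAt xs (suc i)
partAt-antitone {[]} _ _ = z≤n
partAt-antitone {x ∷ xs} {zero} {zero} _ _ = ≤-refl
partAt-antitone {x ∷ []} {zero} {suc j} _ _ = z≤n
partAt-antitone {x ∷ y ∷ xs} {zero} {suc j} (x≥y ∷ dec) _ = ≤-trans (partAt-antitone {i = zero} {j} dec z≤n) x≥y
partAt-antitone {x ∷ xs} {suc i} {suc j} dec (s≤s i≤j) = partAt-antitone (Linked.tail dec) i≤j

diagonal≤partAt : ∀ {k xs r} → Linked _≥_ xs → r < countDiag k xs → k + r ≤ partAt xs (suc r)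
diagonal≤partAt {k} {x ∷ xs} {r} dec r<s with ≤-<-connex k x
diagonal≤partAt {k} {x ∷ xs} {zero} dec r<s | inj₁ k≤x = subst (_≤ x) (sym (+-identityʳ k)) k≤x
diagonal≤partAt {k} {x ∷ xs} {suc r} dec r<s | inj₁ k≤x =
  subst (_≤ partAt xs (suc r)) (sym (+-suc k r))
    (diagonal≤partAt (Linked.tail dec) (s≤s⁻¹ (subst (suc r <_) (countDiag-accept xs k≤x) r<s)))
... | inj₂ x<k = contradiction (subst (r <_) (countDiag-none (decreasing-All< dec x<k)) r<s) n≮0

arm-strictlyDecreasing : ∀ {xs i j} → Linked _≥_ xs → i < j → j < countDiag 1 xs → arm xs j < arm xs i
arm-strictlyDecreasing {xs} {i} {j} dec i<j j<s = +-cancelʳ-< (suc j) (arm xs j) (arm xs i) (begin-strict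
  arm xs j + suc j   ≡⟨ m∸n+n≡m (diagonal≤partAt dec j<s) ⟩
  partAt xs (suc j)  ≤⟨ partAt-antitone dec (<⇒≤ i<j) ⟩
  partAt xs (suc i)  ≡⟨ m∸n+n≡m (diagonal≤partAt dec (<-trans i<j j<s)) ⟨
  arm xs i + suc i   <⟨ +-monoʳ-< (arm xs i) (s≤s i<j) ⟩
  arm xs i + suc j   ∎)
  where open ≤-Reasoning

armList-unique : ∀ λp → Unique (armList λp)
armList-unique λp = applyUpTo⁺₁ (arm (parts λp)) (durfee λp)
  (λ i<j j<s → >⇒≢ (arm-strictlyDecreasing (decreasing λp) i<j j<s))

∈-armList⇔InArm : ∀ λp {x} → x ∈ armList λp ⇔ InArm λp x
∈-armList⇔InArm λp = mk⇔ to from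
  where
  to : ∀ {x} → x ∈ armList λp → InArm λp x
  to x∈ with r , r<s , refl ← ∈-applyUpTo⁻ (arm (parts λp)) x∈ = suc r , s≤s z≤n , r<s , refl
  from : ∀ {x} → InArm λp x → x ∈ armList λp
  from (suc r , _ , r<s , refl) = ∈-applyUpTo⁺ (arm (parts λp)) r<s

-- The arm set of λ_c

positivePart : ℤ → ℕ
positivePart (+ n) = n
positivePart -[1+ n ] = 0

+<⇔<positivePart : ∀ {q} c → + q ℤ.< c ⇔ q < positivePart c
+<⇔<positivePart (+ n) = mk⇔ ℤP.drop‿+<+ ℤ.+<+
+<⇔<positivePart -[1+ n ] = mk⇔ (λ ()) (λ ())

positivePart-neg-pos : ∀ p → positivePart (ℤ.- + p) ≡ 0
positivePart-neg-pos zero = refl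
positivePart-neg-pos (suc p) = refl

residueArms : ℕ → ℕ → ℕ → List ℕ
residueArms t j p = applyDownFrom (λ q → q * t + j) p

armsOf : ℕ → (ℕ → ℤ) → List ℕ
armsOf t c = concat (applyDownFrom (λ j → residueArms t j (positivePart (c j))) t)

∈-armsOf⇔InArmC : ∀ t c {x} → x ∈ armsOf t c ⇔ InArmC t c x
∈-armsOf⇔InArmC t c = mk⇔ to from
  where
  to : ∀ {x} → x ∈ armsOf t c → InArmC t c x
  to x∈ =
    let j , j<t , x∈j = Any.applyDownFrom⁻ _ (∈-concat⁻ _ x∈)
        q , q<p , x≡ = ∈-applyDownFrom⁻ _ x∈j
    in  j , q , j<t , Equivalence.from (+<⇔<positivePart (c j)) q<p , x≡
  from : ∀ {x} → InArmC t c x → x ∈ armsOf t c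
  from (j , q , j<t , q<c , refl) =
    ∈-concat⁺ (Any.applyDownFrom⁺ _ (∈-applyDownFrom⁺ _ (Equivalence.to (+<⇔<positivePart (c j)) q<c)) j<t)

divMod-injective : ∀ {t q q′ j j′} → j < t → j′ < t → q * t + j ≡ q′ * t + j′ → q ≡ q′ × j ≡ j′
divMod-injective {t@(suc _)} {q} {q′} {j} {j′} j<t j′<t eq =
  *-cancelʳ-≡ q q′ t (+-cancelʳ-≡ j (q * t) (q′ * t) (trans eq (cong (λ i → q′ * t + i) (sym j≡j′)))) , j≡j′
  where
  remainder : ∀ {k i} → i < t → (k * t + i) % t ≡ i
  remainder {k} {i} i<t = begin
    (k * t + i) % t  ≡⟨ cong (_% t) (+-comm (k * t) i) ⟩
    (i + k * t) % t  ≡⟨ [m+kn]%n≡m%n i k t ⟩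
    i % t            ≡⟨ m<n⇒m%n≡m i<t ⟩
    i                ∎
    where open ≡-Reasoning
  j≡j′ : j ≡ j′
  j≡j′ = trans (sym (remainder {q} j<t)) (trans (cong (_% t) eq) (remainder {q′} j′<t))

armsOf-unique : ∀ t c → Unique (armsOf t c)
armsOf-unique t c = concat⁺
  (All.applyDownFrom⁺₁ _ t (λ j<t → applyDownFrom⁺₁ _ _ (λ q′<q _ eq → >⇒≢ q′<q (proj₁ (divMod-injective j<t j<t eq)))))
  (AllPairs.applyDownFrom⁺₁ _ t disjoint)
  where
  disjoint : ∀ {j j′} → j′ < j → j < t →
             Disjoint (residueArms t j (positivePart (c j))) (residueArms t j′ (positivePart (c j′)))
  disjoint j′<j j<t (v∈ , v∈′) =
    let q , _ , v≡ = ∈-applyDownFrom⁻ _ v∈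
        q′ , _ , v≡′ = ∈-applyDownFrom⁻ _ v∈′
    in  >⇒≢ j′<j (proj₂ (divMod-injective {q = q} {q′} j<t (<-trans j′<j j<t) (trans (sym v≡) v≡′)))

residueSum : ℕ → ℕ → ℕ → ℕ
residueSum t j p = sum (map (λ a → a + a + 1) (residueArms t j p))

residueContribution : ℕ → (ℕ → ℤ) → ℕ → ℕ
residueContribution t c j = residueSum t j (positivePart (c j))

size-selfConjugate-armsOf : ∀ t c (λp : Partition) → SelfConjugate λp →
  (∀ x → (InArm λp x → InArmC t c x) × (InArmC t c x → InArm λp x)) →
  size λp ≡ sum (applyDownFrom (residueContribution t c) t)
size-selfConjugate-armsOf t c λp sc arms = begin
  size λp                                                    ≡⟨ size-selfConjugate λp sc ⟩
  sum (map hook (armList λp))                                ≡⟨ sum-↭ (map⁺ hook armList↭armsOf) ⟩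
  sum (map hook (concat classes))                            ≡⟨ cong sum (concat-map classes) ⟨
  sum (concat (map (map hook) classes))                      ≡⟨ sum-concat (map (map hook) classes) ⟩
  sum (map sum (map (map hook) classes))                     ≡⟨ cong (λ l → sum (map sum l)) (map-applyDownFrom class (map hook) t) ⟩
  sum (map sum (applyDownFrom (λ j → map hook (class j)) t)) ≡⟨ cong sum (map-applyDownFrom (λ j → map hook (class j)) sum t) ⟩
  sum (applyDownFrom (residueContribution t c) t)            ∎
  where
  open ≡-Reasoning
  hook : ℕ → ℕ
  hook a = a + a + 1
  class : ℕ → List ℕ
  class j = residueArms t j (positivePart (c j))
  classes : List (List ℕ)
  classes = applyDownFrom class t
  sameArms : armList λp ∼[ set ] armsOf t c
  sameArms {x} = ⇔-trans (∈-armList⇔InArm λp)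
    (⇔-trans (mk⇔ (proj₁ (arms x)) (proj₂ (arms x))) (⇔-sym (∈-armsOf⇔InArmC t c)))
  armList↭armsOf = ∼bag⇒↭ (unique∧set⇒bag (armList-unique λp) (armsOf-unique t c) sameArms)

size-λc : ∀ {t n c} → InSC t n c → + n ≡ sumℤ t (λ j → + residueContribution t c j)
size-λc {t} {c = c} (_ , λp , (arms , _) , refl , sc) =
  trans (cong +_ (size-selfConjugate-armsOf t c λp sc arms)) (sum-applyDownFrom-ℤ t (residueContribution t c))

residueSum-closed : ∀ t j p → residueSum t j p + t * p ≡ t * (p * p) + (2 * j + 1) * p
residueSum-closed t j zero = empty t j
  where
  empty : ∀ t j → 0 + t * 0 ≡ t * (0 * 0) + (2 * j + 1) * 0
  empty = ℕ-Solver.solve-∀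
residueSum-closed t j (suc p) = begin
  hook + residueSum t j p + t * suc p         ≡⟨ regroup (residueSum t j p) t j p ⟩
  (residueSum t j p + t * p) + (hook + t)     ≡⟨ cong (_+ (hook + t)) (residueSum-closed t j p) ⟩
  t * (p * p) + (2 * j + 1) * p + (hook + t)  ≡⟨ expand t j p ⟩
  t * (suc p * suc p) + (2 * j + 1) * suc p   ∎
  where
  open ≡-Reasoning
  hook : ℕ
  hook = p * t + j + (p * t + j) + 1
  regroup : ∀ R t j p → p * t + j + (p * t + j) + 1 + R + t * suc p ≡ (R + t * p) + (p * t + j + (p * t + j) + 1 + t)
  regroup = ℕ-Solver.solve-∀
  expand : ∀ t j p → t * (p * p) + (2 * j + 1) * p + (p * t + j + (p * t + j) + 1 + t) ≡ t * (suc p * suc p) + (2 * j + 1) * suc p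
  expand = ℕ-Solver.solve-∀

residueSum-ℤ : ∀ {t j} (w : ℤ) p → + (2 * j + 1) ≡ + t ℤ.+ w →
               + residueSum t j p ≡ + t ℤ.* (+ p ℤ.* + p) ℤ.+ w ℤ.* + p
residueSum-ℤ {t} {j} w p e = begin
  R                                                    ≡⟨ isolate R T P ⟩
  (R ℤ.+ T ℤ.* P) ℤ.- T ℤ.* P                          ≡⟨ cong (ℤ._- T ℤ.* P) closed ⟩
  (T ℤ.* (P ℤ.* P) ℤ.+ A ℤ.* P) ℤ.- T ℤ.* P            ≡⟨ cong (λ a → (T ℤ.* (P ℤ.* P) ℤ.+ a ℤ.* P) ℤ.- T ℤ.* P) e ⟩
  (T ℤ.* (P ℤ.* P) ℤ.+ (T ℤ.+ w) ℤ.* P) ℤ.- T ℤ.* P    ≡⟨ simplify T P w ⟩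
  T ℤ.* (P ℤ.* P) ℤ.+ w ℤ.* P                          ∎
  where
  open ≡-Reasoning
  R T P A : ℤ
  R = + residueSum t j p
  T = + t
  P = + p
  A = + (2 * j + 1)
  closed : R ℤ.+ T ℤ.* P ≡ T ℤ.* (P ℤ.* P) ℤ.+ A ℤ.* P
  closed = begin
    R ℤ.+ T ℤ.* P                            ≡⟨ cong (λ x → R ℤ.+ x) (ℤP.pos-* t p) ⟨
    + (residueSum t j p + t * p)             ≡⟨ cong +_ (residueSum-closed t j p) ⟩
    + (t * (p * p) + (2 * j + 1) * p)        ≡⟨ ℤP.pos-+ (t * (p * p)) ((2 * j + 1) * p) ⟩
    + (t * (p * p)) ℤ.+ + ((2 * j + 1) * p)  ≡⟨ cong₂ ℤ._+_ (trans (ℤP.pos-* t (p * p)) (cong (λ x → T ℤ.* x) (ℤP.pos-* p p)))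
                                                           (ℤP.pos-* (2 * j + 1) p) ⟩
    T ℤ.* (P ℤ.* P) ℤ.+ A ℤ.* P              ∎
  isolate : ∀ R T P → R ≡ (R ℤ.+ T ℤ.* P) ℤ.- T ℤ.* P
  isolate = ℤ-Solver.solve-∀
  simplify : ∀ T P w → (T ℤ.* (P ℤ.* P) ℤ.+ (T ℤ.+ w) ℤ.* P) ℤ.- T ℤ.* P ≡ T ℤ.* (P ℤ.* P) ℤ.+ w ℤ.* P
  simplify = ℤ-Solver.solve-∀

-- Of the classes j and i only the one whose coordinate (−D resp. D) is positive contributes,
-- and relative to t their weights 2j + 1 and 2i + 1 are −w and w, so both cases agree.
residueSum-antipodal : ∀ {t i j} w (D : ℤ) → 2 * i + 1 ≡ t + w → 2 * j + 1 + w ≡ t →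
  + residueSum t j (positivePart (ℤ.- D)) ℤ.+ + residueSum t i (positivePart D) ≡ + t ℤ.* (D ℤ.* D) ℤ.+ + w ℤ.* D
residueSum-antipodal {t} {i} {j} w (+ p) upper _ rewrite positivePart-neg-pos p = begin
  + 0 ℤ.+ + residueSum t i p             ≡⟨ ℤP.+-identityˡ _ ⟩
  + residueSum t i p                     ≡⟨ residueSum-ℤ (+ w) p (trans (cong +_ upper) (ℤP.pos-+ t w)) ⟩
  + t ℤ.* (+ p ℤ.* + p) ℤ.+ + w ℤ.* + p  ∎
  where open ≡-Reasoning
residueSum-antipodal {t} {i} {j} w -[1+ p ] _ lower = begin
  + residueSum t j (suc p) ℤ.+ + 0                         ≡⟨ ℤP.+-identityʳ _ ⟩
  + residueSum t j (suc p)                                 ≡⟨ residueSum-ℤ (ℤ.- + w) (suc p) lowerℤ ⟩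
  + t ℤ.* (+ suc p ℤ.* + suc p) ℤ.+ (ℤ.- + w) ℤ.* + suc p  ≡⟨ reflect (+ t) (+ w) (+ suc p) ⟩
  + t ℤ.* (-[1+ p ] ℤ.* -[1+ p ]) ℤ.+ + w ℤ.* -[1+ p ]      ∎
  where
  open ≡-Reasoning
  reflect : ∀ T W P → T ℤ.* (P ℤ.* P) ℤ.+ (ℤ.- W) ℤ.* P ≡ T ℤ.* (ℤ.- P ℤ.* ℤ.- P) ℤ.+ W ℤ.* ℤ.- P
  reflect = ℤ-Solver.solve-∀
  shift : ∀ A W → A ≡ (A ℤ.+ W) ℤ.- W
  shift = ℤ-Solver.solve-∀
  lowerℤ : + (2 * j + 1) ≡ + t ℤ.+ ℤ.- + w
  lowerℤ = begin
    + (2 * j + 1)                    ≡⟨ shift (+ (2 * j + 1)) (+ w) ⟩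
    (+ (2 * j + 1) ℤ.+ + w) ℤ.- + w  ≡⟨ cong (ℤ._- + w) (ℤP.pos-+ (2 * j + 1) w) ⟨
    + (2 * j + 1 + w) ℤ.- + w        ≡⟨ cong (λ x → + x ℤ.- + w) lower ⟩
    + t ℤ.+ ℤ.- + w                  ∎

antipodalSum : ∀ t c m (lo hi w : ℕ → ℕ) (D : ℕ → ℤ) →
  (∀ k → k < m → c (lo k) ≡ ℤ.- D k × c (hi k) ≡ D k) →
  (∀ k → k < m → 2 * lo k + 1 + w k ≡ t × 2 * hi k + 1 ≡ t + w k) →
  sumℤ m (λ k → + residueContribution t c (lo k) ℤ.+ + residueContribution t c (hi k))
    ≡ + t ℤ.* sumℤ m (λ k → D k ℤ.* D k) ℤ.+ sumℤ m (λ k → + w k ℤ.* D k)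
antipodalSum t c m lo hi w D values weights = begin
  sumℤ m (λ k → + residueContribution t c (lo k) ℤ.+ + residueContribution t c (hi k))
    ≡⟨ sumℤ-cong m pair ⟩
  sumℤ m (λ k → + t ℤ.* (D k ℤ.* D k) ℤ.+ + w k ℤ.* D k)
    ≡⟨ sumℤ-+ m (λ k → + t ℤ.* (D k ℤ.* D k)) (λ k → + w k ℤ.* D k) ⟩
  sumℤ m (λ k → + t ℤ.* (D k ℤ.* D k)) ℤ.+ sumℤ m (λ k → + w k ℤ.* D k)
    ≡⟨ cong (ℤ._+ sumℤ m (λ k → + w k ℤ.* D k)) (sumℤ-*ˡ m (+ t) (λ k → D k ℤ.* D k)) ⟩
  + t ℤ.* sumℤ m (λ k → D k ℤ.* D k) ℤ.+ sumℤ m (λ k → + w k ℤ.* D k) ∎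
  where
  open ≡-Reasoning
  pair : ∀ k → k < m →
         + residueContribution t c (lo k) ℤ.+ + residueContribution t c (hi k) ≡ + t ℤ.* (D k ℤ.* D k) ℤ.+ + w k ℤ.* D k
  pair k k<m =
    let c-lo , c-hi = values k k<m
        lower , upper = weights k k<m
    in  trans (cong₂ (λ a b → + residueSum t (lo k) (positivePart a) ℤ.+ + residueSum t (hi k) (positivePart b)) c-lo c-hi)
              (residueSum-antipodal (w k) (D k) upper lower)

oddVec-centre : ∀ m d → oddVec m d m ≡ + 0
oddVec-centre m d with m <? m
... | yes m<m = contradiction m<m (<-irrefl refl)
... | no _ with m <? m
...   | yes m<m = contradiction m<m (<-irrefl refl)
...   | no _ = refl

oddVec-upper : ∀ m d k → oddVec m d (suc m + k) ≡ d (suc k)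
oddVec-upper m d k with suc m + k <? m
... | yes m+k<m = contradiction m+k<m (≤⇒≯ (≤-trans (n≤1+n m) (m≤m+n (suc m) k)))
... | no _ with m <? suc m + k
...   | yes _ = cong d (trans (cong (_∸ m) (sym (+-suc m k))) (m+n∸m≡n m (suc k)))
...   | no m≮ = contradiction (s≤s (m≤m+n m k)) m≮

oddVec-lower : ∀ m d {k} → k < m → oddVec m d (m ∸ suc k) ≡ ℤ.- d (suc k)
oddVec-lower m d {k} k<m with m ∸ suc k <? m
... | yes _ = cong (λ i → ℤ.- d i) (m∸[m∸n]≡n k<m)
... | no ≮m = contradiction (∸-monoʳ-< z<s k<m) ≮m

evenVec-upper : ∀ m d k → evenVec m d (m + k) ≡ d (suc k)
evenVec-upper m d k with m + k <? m
... | yes m+k<m = contradiction m+k<m (≤⇒≯ (m≤m+n m k))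
... | no _ = cong (λ i → d (suc i)) (m+n∸m≡n m k)

evenVec-lower : ∀ m d {k} → k < m → evenVec m d (m ∸ suc k) ≡ ℤ.- d (suc k)
evenVec-lower m d {k} k<m with m ∸ suc k <? m
... | yes _ = cong (λ i → ℤ.- d i) (m∸[m∸n]≡n k<m)
... | no ≮m = contradiction (∸-monoʳ-< z<s k<m) ≮m

selfConjugate-size-odd : ∀ m n d → InSC (2 * m + 1) n (oddVec m d) →
  + n ≡ + (2 * m + 1) ℤ.* sumℤ m (λ k → d (suc k) ℤ.* d (suc k)) ℤ.+ sumℤ m (λ k → + (2 * suc k) ℤ.* d (suc k))
selfConjugate-size-odd m n d isc = begin
  + n                                                     ≡⟨ size-λc isc ⟩
  sumℤ t G                                                ≡⟨ cong (λ s → sumℤ s G) (length≡ m) ⟩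
  sumℤ (suc m + m) G                                      ≡⟨ sumℤ-foldOdd m G ⟩
  G m ℤ.+ sumℤ m (λ k → G (m ∸ suc k) ℤ.+ G (suc m + k))
    ≡⟨ cong₂ ℤ._+_ (cong (λ a → + residueSum t m (positivePart a)) (oddVec-centre m d))
                   (antipodalSum t c m (λ k → m ∸ suc k) (λ k → suc m + k) (λ k → 2 * suc k) (λ k → d (suc k)) values weights) ⟩
  + 0 ℤ.+ (+ t ℤ.* sumℤ m (λ k → d (suc k) ℤ.* d (suc k)) ℤ.+ sumℤ m (λ k → + (2 * suc k) ℤ.* d (suc k)))
    ≡⟨ ℤP.+-identityˡ _ ⟩
  + t ℤ.* sumℤ m (λ k → d (suc k) ℤ.* d (suc k)) ℤ.+ sumℤ m (λ k → + (2 * suc k) ℤ.* d (suc k)) ∎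
  where
  open ≡-Reasoning
  t : ℕ
  t = 2 * m + 1
  c : ℕ → ℤ
  c = oddVec m d
  G : ℕ → ℤ
  G j = + residueContribution t c j
  length≡ : ∀ m → 2 * m + 1 ≡ suc m + m
  length≡ = ℕ-Solver.solve-∀
  values : ∀ k → k < m → c (m ∸ suc k) ≡ ℤ.- d (suc k) × c (suc m + k) ≡ d (suc k)
  values k k<m = oddVec-lower m d k<m , oddVec-upper m d k
  lower : ∀ {u k m} → u + suc k ≡ m → 2 * u + 1 + 2 * suc k ≡ 2 * m + 1
  lower {u} {k} refl = identity u k
    where
    identity : ∀ u k → 2 * u + 1 + 2 * suc k ≡ 2 * (u + suc k) + 1
    identity = ℕ-Solver.solve-∀
  upper : ∀ m k → 2 * (suc m + k) + 1 ≡ 2 * m + 1 + 2 * suc k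
  upper = ℕ-Solver.solve-∀
  weights : ∀ k → k < m → 2 * (m ∸ suc k) + 1 + 2 * suc k ≡ t × 2 * (suc m + k) + 1 ≡ t + 2 * suc k
  weights k k<m = lower (m∸n+n≡m k<m) , upper m k

selfConjugate-size-even : ∀ m n d → InSC (2 * m) n (evenVec m d) →
  + n ≡ + (2 * m) ℤ.* sumℤ m (λ k → d (suc k) ℤ.* d (suc k)) ℤ.+ sumℤ m (λ k → + (2 * suc k ∸ 1) ℤ.* d (suc k))
selfConjugate-size-even m n d isc = begin
  + n                                         ≡⟨ size-λc isc ⟩
  sumℤ t G                                    ≡⟨ cong (λ s → sumℤ s G) (length≡ m) ⟩
  sumℤ (m + m) G                              ≡⟨ sumℤ-foldEven m G ⟩
  sumℤ m (λ k → G (m ∸ suc k) ℤ.+ G (m + k))  ≡⟨ antipodalSum t c m (λ k → m ∸ suc k) (λ k → m + k) w (λ k → d (suc k)) values weights ⟩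
  + t ℤ.* sumℤ m (λ k → d (suc k) ℤ.* d (suc k)) ℤ.+ sumℤ m (λ k → + w k ℤ.* d (suc k)) ∎
  where
  open ≡-Reasoning
  t : ℕ
  t = 2 * m
  c : ℕ → ℤ
  c = evenVec m d
  w : ℕ → ℕ
  w k = 2 * suc k ∸ 1
  G : ℕ → ℤ
  G j = + residueContribution t c j
  length≡ : ∀ m → 2 * m ≡ m + m
  length≡ = ℕ-Solver.solve-∀
  values : ∀ k → k < m → c (m ∸ suc k) ≡ ℤ.- d (suc k) × c (m + k) ≡ d (suc k)
  values k k<m = evenVec-lower m d k<m , evenVec-upper m d k
  w≡ : ∀ k → w k ≡ 2 * k + 1
  w≡ k = cong (_∸ 1) (double k)
    where
    double : ∀ k → 2 * suc k ≡ suc (2 * k + 1)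
    double = ℕ-Solver.solve-∀
  lower : ∀ {u k m} → u + suc k ≡ m → 2 * u + 1 + (2 * k + 1) ≡ 2 * m
  lower {u} {k} refl = identity u k
    where
    identity : ∀ u k → 2 * u + 1 + (2 * k + 1) ≡ 2 * (u + suc k)
    identity = ℕ-Solver.solve-∀
  upper : ∀ m k → 2 * (m + k) + 1 ≡ 2 * m + (2 * k + 1)
  upper = ℕ-Solver.solve-∀
  weights : ∀ k → k < m → 2 * (m ∸ suc k) + 1 + w k ≡ t × 2 * (m + k) + 1 ≡ t + w k
  weights k k<m rewrite w≡ k = lower (m∸n+n≡m k<m) , upper m k

corollary3p21 :
    ((m n : ℕ) (d : ℕ → ℤ) → 1 ≤ n →
      InSC (2 * m + 1) n (oddVec m d) →
      + n ≡ (+ (2 * m + 1)) ℤ.* sumℤ m (λ k → d (suc k) ℤ.* d (suc k))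
             ℤ.+ sumℤ m (λ k → (+ (2 * suc k)) ℤ.* d (suc k)))
    ×
    ((m n : ℕ) (d : ℕ → ℤ) → 1 ≤ m → 1 ≤ n →
      InSC (2 * m) n (evenVec m d) →
      + n ≡ (+ (2 * m)) ℤ.* sumℤ m (λ k → d (suc k) ℤ.* d (suc k))
             ℤ.+ sumℤ m (λ k → (+ (2 * suc k ∸ 1)) ℤ.* d (suc k)))
corollary3p21 =
  (λ m n d _ → selfConjugate-size-odd m n d) ,
  (λ m n d _ _ → selfConjugate-size-even m n d)
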